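{- Let $\mathcal A$ be a commutative unital integral domain, let $n$ be a positive integer and let $u_0,u_1,\dots,u_n,a,b\in\mathcal A$. Assume that: 1. each of $u_0,u_1,\dots,u_n$ divides $a$ in $\mathcal A$; 2. for each $i\in\{0,1,\dots,n\}$, the element $\prod_{0\le j\le n,\ j\neq i}(u_i-u_j)$ divides $b$ in $\mathcal A$. Then the product $ab$ is a multiple in $\mathcal A$ of the product $u_0u_1\cdots u_n$. -}

module Defs where

open import Level using (_⊔_)
open import Algebra.Bundles using (CommutativeRing)
open import Data.Nat.Base using (ℕ)
open import Data.Sum.Base using (_⊎_)
open import Relation.Nullary using (¬_)
import Algebra.Definitions.RawMagma as RawMagmaDefs
import Algebra.Definitions.RawMonoid as RawMonoidDefs

record IsIntegralDomain {c ℓ} (R : CommutativeRing c ℓ) : Set (c ⊔ ℓ) where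
  open CommutativeRing R
  field
    nontrivial      : ¬ (1# ≈ 0#)
    noZeroDivisors  : ∀ x y → x * y ≈ 0# → (x ≈ 0#) ⊎ (y ≈ 0#)

module RingNotation {c ℓ} (R : CommutativeRing c ℓ) where
  open CommutativeRing R
  -- divisibility  x ∣ y  ⇔  ∃ q. q * x ≈ y   (stdlib's multiplicative divisibility)
  open RawMagmaDefs *-rawMagma public using (_∣_)
  open RawMonoidDefs *-rawMonoid public using () renaming (sum to ∏)

-- Write β i = b / ∏_{j ≠ i} (u i − u j).  Lagrange interpolation of the constant b
-- at the nodes u₀, …, uₙ gives  ∑ᵢ β i · ∏_{j ≠ i} (x − u j) = b  for every x.  By
-- induction on n, removing the node u₀, this reduces to ∑ᵢ β i = 0; at x = u₀ the
-- induction hypothesis gives (∑ᵢ β i) · ∏_{j ≠ 0} (u₀ − u j) = 0, and in an integral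
-- domain either the sum vanishes or the product does, in which case b = 0 and there
-- is nothing to prove.  At x = 0 every summand a · β i · ∏_{j ≠ i} (− u j) is a
-- multiple of u i · ∏_{j ≠ i} u j = ∏ u, since u i ∣ a.

module Submission where

open import Defs
open import Algebra.Bundles using (CommutativeMonoid; Semiring; Ring; CommutativeRing)
open import Data.Nat.Base using (ℕ; zero; suc; _≤_)
open import Data.Fin.Base using (Fin; zero; suc; punchIn)
open import Data.Sum.Base using (_⊎_; inj₁; inj₂; [_,_]′)
open import Data.Vec.Functional using (Vector; tail; replicate)
import Algebra.Definitions.RawMagma as RawMagmaDefs
import Algebra.Definitions.RawMonoid as RawMonoidDefs
import Algebra.Properties.CommutativeSemigroup as CommutativeSemigroupProperties
import Algebra.Properties.CommutativeSemigroup.Divisibility as CommutativeSemigroupDivisibility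
import Algebra.Properties.CommutativeMonoid.Sum as CommutativeMonoidSum
import Algebra.Properties.Monoid.Divisibility as MonoidDivisibility
import Algebra.Properties.Semiring.Divisibility as SemiringDivisibility
import Algebra.Properties.Semiring.Sum as SemiringSum
import Algebra.Properties.Ring as RingProperties
import Relation.Binary.Reasoning.Setoid as SetoidReasoning

module _ {a ℓ} (M : CommutativeMonoid a ℓ) where
  open CommutativeMonoid M
  open RawMagmaDefs rawMagma using (_∣_)
  open RawMonoidDefs rawMonoid using () renaming (sum to ∏)
  open CommutativeSemigroupDivisibility commutativeSemigroup using (∙-cong-∣)
  open MonoidDivisibility monoid using (∣ʳ-refl)

  ∏-mono-∣ : ∀ {n} (f g : Vector Carrier n) → (∀ i → f i ∣ g i) → ∏ f ∣ ∏ g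
  ∏-mono-∣ {zero}  f g f∣g = ∣ʳ-refl
  ∏-mono-∣ {suc n} f g f∣g = ∙-cong-∣ (f∣g zero) (∏-mono-∣ (tail f) (tail g) (λ i → f∣g (suc i)))

module _ {a ℓ} (R : Semiring a ℓ) where
  open Semiring R hiding (zero)
  open RawMagmaDefs *-rawMagma using (_∣_; _,_)
  open SemiringSum R using (sum)

  ∣-sum : ∀ {n} d (f : Vector Carrier n) → (∀ i → d ∣ f i) → d ∣ sum f
  ∣-sum {zero}  d f d∣f = 0# , zeroˡ d
  ∣-sum {suc n} d f d∣f with d∣f zero | ∣-sum d (tail f) (λ i → d∣f (suc i))
  ... | p , pd≈f₀ | q , qd≈∑f = p + q , trans (distribʳ d p q) (+-cong pd≈f₀ qd≈∑f)

module _ {c ℓ} (R : Ring c ℓ) where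
  open Ring R
  open RawMagmaDefs *-rawMagma using (_∣_; _,_)
  open RingProperties R using (-1*x≈-x)
  open SetoidReasoning setoid

  x-z≈[x-y]+[y-z] : ∀ x y z → x - z ≈ (x - y) + (y - z)
  x-z≈[x-y]+[y-z] x y z = sym (begin
    (x - y) + (y - z)     ≈⟨ +-assoc x (- y) (y - z) ⟩
    x + (- y + (y - z))   ≈⟨ +-congˡ (sym (+-assoc (- y) y (- z))) ⟩
    x + ((- y + y) - z)   ≈⟨ +-congˡ (+-congʳ (-‿inverseˡ y)) ⟩
    x + (0# - z)          ≈⟨ +-congˡ (+-identityˡ (- z)) ⟩
    x - z                 ∎)

  x∣0-x : ∀ x → x ∣ 0# - x
  x∣0-x x = - 1# , trans (-1*x≈-x x) (sym (+-identityˡ (- x)))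

module Interpolation {c ℓ} (R : CommutativeRing c ℓ) where
  open CommutativeRing R hiding (zero)
  open RingNotation R
  open SemiringSum semiring using (sum; sum-cong-≋; sum-replicate-zero; ∑-distrib-+; *-distribˡ-sum; *-distribʳ-sum)
  open CommutativeMonoidSum *-commutativeMonoid using () renaming (sum-remove to ∏-remove)
  open CommutativeSemigroupDivisibility *-commutativeSemigroup using (∙-cong-∣; x∣ʳy⇒x∣ʳzy; ∣ʳ-respˡ-≈; ∣ʳ-respʳ-≈)
  open CommutativeSemigroupProperties *-commutativeSemigroup using (x∙yz≈y∙xz)
  open SetoidReasoning setoid

  nodal : ∀ {n} → Vector Carrier n → Carrier → Carrier
  nodal u x = ∏ (λ k → x - u k)

  nodalExcept : ∀ {n} → Vector Carrier (suc n) → Fin (suc n) → Carrier → Carrier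
  nodalExcept u i x = ∏ (λ k → x - u (punchIn i k))

  lagrangeSum : ∀ {n} → Vector Carrier (suc n) → Vector Carrier (suc n) → Carrier → Carrier
  lagrangeSum u β x = sum (λ i → β i * nodalExcept u i x)

  -- nodalExcept u (suc i) x reduces to (x - u zero) * nodalExcept (tail u) i x,
  -- and nodalExcept u zero to nodal (tail u).
  tailWeights : ∀ {n} → Vector Carrier (suc (suc n)) → Vector Carrier (suc (suc n)) → Vector Carrier (suc n)
  tailWeights u β i = β (suc i) * (u (suc i) - u zero)

  lagrangeSum-tail : ∀ {n} (u β : Vector Carrier (suc (suc n))) x →
    lagrangeSum u β x ≈ lagrangeSum (tail u) (tailWeights u β) x + sum β * nodal (tail u) x
  lagrangeSum-tail u β x = begin
    β₀ * ω + sum (λ i → β (suc i) * ((x - u zero) * N i x))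
      ≈⟨ +-congˡ (sum-cong-≋ split) ⟩
    β₀ * ω + sum (λ i → tailWeights u β i * N i x + β (suc i) * ω)
      ≈⟨ +-congˡ (∑-distrib-+ (λ i → tailWeights u β i * N i x) (λ i → β (suc i) * ω)) ⟩
    β₀ * ω + (S + sum (λ i → β (suc i) * ω))
      ≈⟨ +-congˡ (+-congˡ (sym (*-distribʳ-sum ω (tail β)))) ⟩
    β₀ * ω + (S + sum (tail β) * ω)
      ≈⟨ x+[y+z]≈y+[x+z] (β₀ * ω) S _ ⟩
    S + (β₀ * ω + sum (tail β) * ω)
      ≈⟨ +-congˡ (sym (distribʳ ω β₀ (sum (tail β)))) ⟩
    S + sum β * ω ∎
    where
    β₀ = β zero
    ω = nodal (tail u) x
    N = nodalExcept (tail u)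
    S = lagrangeSum (tail u) (tailWeights u β) x
    open CommutativeSemigroupProperties +-commutativeSemigroup using () renaming (x∙yz≈y∙xz to x+[y+z]≈y+[x+z])
    split : ∀ i → β (suc i) * ((x - u zero) * N i x) ≈ tailWeights u β i * N i x + β (suc i) * ω
    split i = begin
      β (suc i) * ((x - u zero) * N i x)
        ≈⟨ *-congˡ (*-congʳ (x-z≈[x-y]+[y-z] ring x (u (suc i)) (u zero))) ⟩
      β (suc i) * (((x - u (suc i)) + (u (suc i) - u zero)) * N i x)
        ≈⟨ *-congˡ (distribʳ (N i x) _ _) ⟩
      β (suc i) * ((x - u (suc i)) * N i x + (u (suc i) - u zero) * N i x)
        ≈⟨ trans (distribˡ (β (suc i)) _ _) (+-comm _ _) ⟩
      β (suc i) * ((u (suc i) - u zero) * N i x) + β (suc i) * ((x - u (suc i)) * N i x)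
        ≈⟨ +-cong (sym (*-assoc _ _ _)) (*-congˡ (sym (∏-remove {i = i} (λ k → x - u (suc k))))) ⟩
      tailWeights u β i * N i x + β (suc i) * ω ∎

  nodalExcept-suc-at-head : ∀ {n} (u : Vector Carrier (suc n)) i → nodalExcept u (suc i) (u zero) ≈ 0#
  nodalExcept-suc-at-head {suc n} u i = trans (*-congʳ (-‿inverseʳ (u zero))) (zeroˡ _)

  -- β i = b / ∏_{j ≠ i} (u i − u j), without dividing.
  BarycentricMultiple : ∀ {n} → Vector Carrier (suc n) → Carrier → Vector Carrier (suc n) → Set ℓ
  BarycentricMultiple u b β = ∀ i → β i * nodalExcept u i (u i) ≈ b

  lagrangeSum-at-head : ∀ {n} {u β : Vector Carrier (suc n)} {b} →
    BarycentricMultiple u b β → lagrangeSum u β (u zero) ≈ b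
  lagrangeSum-at-head {n} {u} {β} {b} β-bary = begin
    β zero * nodalExcept u zero (u zero) + sum (λ i → β (suc i) * nodalExcept u (suc i) (u zero))
      ≈⟨ +-cong (β-bary zero) (sum-cong-≋ (λ i → trans (*-congˡ (nodalExcept-suc-at-head u i)) (zeroʳ _))) ⟩
    b + sum (replicate n 0#) ≈⟨ +-congˡ (sum-replicate-zero n) ⟩
    b + 0#                   ≈⟨ +-identityʳ b ⟩
    b                        ∎

  tailWeights-barycentric : ∀ {n} {u β : Vector Carrier (suc (suc n))} {b} →
    BarycentricMultiple u b β → BarycentricMultiple (tail u) b (tailWeights u β)
  tailWeights-barycentric β-bary i = trans (*-assoc _ _ _) (β-bary (suc i))

  module _ (domain : IsIntegralDomain R) where
    open IsIntegralDomain domain using (noZeroDivisors)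
    open RingProperties ring using (+-identityʳ-unique)

    lagrangeSum-interpolates : ∀ n {u β : Vector Carrier (suc n)} {b} → BarycentricMultiple u b β →
      b ≈ 0# ⊎ (∀ x → lagrangeSum u β x ≈ b)
    lagrangeSum-interpolates zero β-bary = inj₂ (λ _ → trans (+-identityʳ _) (β-bary zero))
    lagrangeSum-interpolates (suc n) {u} {β} {b} β-bary
      with lagrangeSum-interpolates n (tailWeights-barycentric β-bary)
    ... | inj₁ b≈0 = inj₁ b≈0
    ... | inj₂ tail-interpolates =
      [ (λ ∑β≈0 → inj₂ (interpolates ∑β≈0)) , (λ D₀≈0 → inj₁ (b≈0 D₀≈0)) ]′ (noZeroDivisors (sum β) D₀ ∑β*D₀≈0)
      where
      D₀ = nodal (tail u) (u zero)

      ∑β*D₀≈0 : sum β * D₀ ≈ 0#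
      ∑β*D₀≈0 = +-identityʳ-unique b _ (begin
        b + sum β * D₀
          ≈⟨ +-congʳ (sym (tail-interpolates (u zero))) ⟩
        lagrangeSum (tail u) (tailWeights u β) (u zero) + sum β * D₀
          ≈⟨ sym (lagrangeSum-tail u β (u zero)) ⟩
        lagrangeSum u β (u zero)
          ≈⟨ lagrangeSum-at-head β-bary ⟩
        b ∎)

      interpolates : sum β ≈ 0# → ∀ x → lagrangeSum u β x ≈ b
      interpolates ∑β≈0 x = begin
        lagrangeSum u β x
          ≈⟨ lagrangeSum-tail u β x ⟩
        lagrangeSum (tail u) (tailWeights u β) x + sum β * nodal (tail u) x
          ≈⟨ +-cong (tail-interpolates x) (trans (*-congʳ ∑β≈0) (zeroˡ _)) ⟩
        b + 0#
          ≈⟨ +-identityʳ b ⟩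
        b ∎

      b≈0 : D₀ ≈ 0# → b ≈ 0#
      b≈0 D₀≈0 = trans (sym (β-bary zero)) (trans (*-congˡ D₀≈0) (zeroʳ (β zero)))

  ∏∣*lagrangeSum-at-0 : ∀ {n} (u β : Vector Carrier (suc n)) a → (∀ i → u i ∣ a) → ∏ u ∣ a * lagrangeSum u β 0#
  ∏∣*lagrangeSum-at-0 u β a u∣a =
    ∣ʳ-respʳ-≈ (sym (*-distribˡ-sum a (λ i → β i * nodalExcept u i 0#))) (∣-sum semiring (∏ u) _ ∏∣term)
    where
    ∏∣term : ∀ i → ∏ u ∣ a * (β i * nodalExcept u i 0#)
    ∏∣term i =
      ∣ʳ-respʳ-≈ (x∙yz≈y∙xz (β i) a _) (x∣ʳy⇒x∣ʳzy (β i) (∣ʳ-respˡ-≈ (sym (∏-remove {i = i} u))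
        (∙-cong-∣ (u∣a i) (∏-mono-∣ *-commutativeMonoid _ _ (λ k → x∣0-x ring (u (punchIn i k)))))))

mainTheorem12 : ∀ {c ℓ} (R : CommutativeRing c ℓ) → IsIntegralDomain R →
    let open CommutativeRing R
        open RingNotation R
    in (n : ℕ) → 1 ≤ n → (u : Fin (suc n) → Carrier) → (a b : Carrier) →
       (∀ i → u i ∣ a) →
       (∀ i → ∏ (λ (k : Fin n) → u i - u (punchIn i k)) ∣ b) →
       ∏ u ∣ (a * b)
mainTheorem12 R domain n _ u a b u∣a D∣b =
  [ (λ b≈0 → ∣ʳ-respʳ-≈ (sym (trans (*-congˡ b≈0) (zeroʳ a))) (∏ u ∣0))
  , (λ interpolates → ∣ʳ-respʳ-≈ (*-congˡ (interpolates 0#)) (∏∣*lagrangeSum-at-0 u β a u∣a))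
  ]′ (lagrangeSum-interpolates domain n β-bary)
  where
  open CommutativeRing R hiding (zero)
  open RingNotation R
  open Interpolation R
  open SemiringDivisibility semiring using (_∣0; ∣ʳ-respʳ-≈)
  open RawMagmaDefs._∣ʳ_ using (quotient; equality)

  β : Vector Carrier (suc n)
  β i = quotient (D∣b i)

  β-bary : BarycentricMultiple u b β
  β-bary i = equality (D∣b i)
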